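{- If $f:\mathcal{S}_n\to\mathcal{P}(B)$ is a $(1,2)$-sensitive bucketing function, then $|f(s)|\ge n$ for every $s\in\mathcal{S}_n$.
   Context: $\Sigma$ is a finite alphabet with $|\Sigma|>1$, $n\ge1$, and $\mathcal{S}_n=\Sigma^n$ with the edit (Levenshtein) distance $\mathrm{edit}$. A bucketing function with bucket set $B$ is a map $f:\mathcal{S}_n\to\mathcal{P}(B)$; it is $(d_1,d_2)$-sensitive if for all $s,t\in\mathcal{S}_n$: $\mathrm{edit}(s,t)\le d_1\Rightarrow f(s)\cap f(t)\neq\emptyset$ and $\mathrm{edit}(s,t)\ge d_2\Rightarrow f(s)\cap f(t)=\emptyset$. -}

module Defs where

open import Level using (Level; _⊔_) renaming (suc to lsuc)
open import Data.Nat using (ℕ; zero; suc; _⊓_; _≤_; _≥_)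
open import Data.List using (List; []; _∷_; length)
open import Data.Vec using (Vec; toList)
open import Data.Fin using (Fin)
open import Data.Product using (Σ; _×_; ∃)
open import Relation.Nullary using (¬_; Dec; yes; no)
open import Relation.Binary.PropositionalEquality using (_≡_)
open import Function.Definitions using (Injective)

module _ {a : Level} {A : Set a} (_≟_ : (x y : A) → Dec (x ≡ y)) where

  lev : List A → List A → ℕ
  lev [] ys = length ys
  lev (x ∷ xs) ys = go ys
    where
    -- go ys' computes lev (x ∷ xs) ys'
    go : List A → ℕ
    go [] = suc (length xs)
    go (y ∷ ys') = suc (lev xs (y ∷ ys')) ⊓ suc (go ys') ⊓ subst-cost
      where
      subst-cost : ℕ
      subst-cost with x ≟ y
      ... | yes _ = lev xs ys'
      ... | no _  = suc (lev xs ys')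

Str : ℕ → ℕ → Set
Str q n = Vec (Fin q) n

edit : {q n : ℕ} → Str q n → Str q n → ℕ
edit s t = lev Data.Fin._≟_ (toList s) (toList t)

Bucketing : ∀ {b} (q n : ℕ) (B : Set b) → Set (lsuc b)
Bucketing {b} q n B = Str q n → B → Set b

Sensitive : ∀ {b} {q n : ℕ} {B : Set b} → ℕ → ℕ → Bucketing q n B → Set b
Sensitive {q = q} {n} {B} d₁ d₂ f =
  ((s t : Str q n) → edit s t ≤ d₁ → Σ B (λ x → f s x × f t x)) ×
  ((s t : Str q n) → edit s t ≥ d₂ → (x : B) → ¬ (f s x × f t x))

AtLeast : ∀ {b} {B : Set b} → ℕ → (B → Set b) → Set b
AtLeast {B = B} k P = Σ (Fin k → B) (λ g → Injective _≡_ _≡_ g × ((i : Fin k) → P (g i)))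

{-# OPTIONS --safe #-}
module Submission where

-- Let t_i be s with its i-th letter replaced by a different one. Each t_i is at edit
-- distance 1 from s, so f s and f t_i share a bucket b_i. For i ≠ j the strings t_i and
-- t_j differ in two positions, and equal-length strings at edit distance at most 1
-- differ in at most one position; hence edit(t_i, t_j) ≥ 2, f t_i and f t_j are
-- disjoint, and the n buckets b_i are pairwise distinct.

open import Defs
open import Level using (Level)
open import Data.Nat using (ℕ; zero; suc; _⊓_; _≤_; _≥_; z≤n; s≤s)
open import Data.Nat.Properties using (⊓-sel; m⊓n≤n; ≤-trans; ≤-reflexive; n≤0⇒n≡0; ≰⇒>)
open import Data.List using ([]; _∷_; length)
open import Data.Vec using (Vec; []; _∷_; toList; lookup; _[_]≔_)
open import Data.Vec.Properties using (length-toList; toList-injective; cast-is-id; lookup∘update; lookup∘update′)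
open import Data.Fin using (Fin; zero; suc)
import Data.Fin.Properties as Fin
open import Data.Product using (Σ; _×_; _,_; proj₁; proj₂)
open import Data.Sum using (_⊎_; inj₁; inj₂)
open import Data.Empty using (⊥-elim)
open import Relation.Nullary using (yes; no)
open import Relation.Nullary.Decidable using (decidable-stable)
open import Relation.Binary.Definitions using (DecidableEquality)
open import Relation.Binary.PropositionalEquality using (_≡_; _≢_; refl; sym; trans; cong; subst; module ≡-Reasoning)

⊓-≤⇒⊎ : ∀ m n {o} → m ⊓ n ≤ o → m ≤ o ⊎ n ≤ o
⊓-≤⇒⊎ m n m⊓n≤o with ⊓-sel m n
... | inj₁ m⊓n≡m = inj₁ (subst (_≤ _) m⊓n≡m m⊓n≤o)
... | inj₂ m⊓n≡n = inj₂ (subst (_≤ _) m⊓n≡n m⊓n≤o)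

⊓₃-≤⇒⊎ : ∀ m n p {o} → m ⊓ n ⊓ p ≤ o → m ≤ o ⊎ n ≤ o ⊎ p ≤ o
⊓₃-≤⇒⊎ m n p h with ⊓-≤⇒⊎ (m ⊓ n) p h
... | inj₂ p≤o = inj₂ (inj₂ p≤o)
... | inj₁ m⊓n≤o with ⊓-≤⇒⊎ m n m⊓n≤o
...   | inj₁ m≤o = inj₁ m≤o
...   | inj₂ n≤o = inj₂ (inj₁ n≤o)

toList≢∷toList : ∀ {A : Set} {n} (u v : Vec A n) y → toList u ≢ y ∷ toList v
toList≢∷toList u v y eq with
  trans (sym (length-toList u)) (trans (cong length eq) (cong suc (length-toList v)))
... | ()

module _ {A : Set} (_≟_ : DecidableEquality A) where

  lev≤0⇒≡ : ∀ xs ys → lev _≟_ xs ys ≤ 0 → xs ≡ ys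
  lev≤0⇒≡ []       []       _ = refl
  lev≤0⇒≡ (x ∷ xs) (y ∷ ys) h with ⊓₃-≤⇒⊎ _ _ _ h
  ... | inj₂ (inj₂ h′) with x ≟ y
  ...   | yes refl = cong (x ∷_) (lev≤0⇒≡ xs ys h′)

  lev-refl : ∀ xs → lev _≟_ xs xs ≡ 0
  lev-refl []       = refl
  lev-refl (x ∷ xs) with x ≟ x
  ... | yes _  = n≤0⇒n≡0 (≤-trans (m⊓n≤n _ _) (≤-reflexive (lev-refl xs)))
  ... | no x≢x = ⊥-elim (x≢x refl)

  lev-[]≔≤1 : ∀ {n} (u : Vec A n) i c → lev _≟_ (toList u) (toList (u [ i ]≔ c)) ≤ 1
  lev-[]≔≤1 (x ∷ u) zero c with x ≟ c
  ... | yes _ = ≤-trans (m⊓n≤n _ _) (≤-trans (≤-reflexive (lev-refl (toList u))) z≤n)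
  ... | no _  = ≤-trans (m⊓n≤n _ _) (s≤s (≤-reflexive (lev-refl (toList u))))
  lev-[]≔≤1 (x ∷ u) (suc i) c with x ≟ x
  ... | yes _  = ≤-trans (m⊓n≤n _ _) (lev-[]≔≤1 u i c)
  ... | no x≢x = ⊥-elim (x≢x refl)

  suc-lev≤1⇒≡ : ∀ {n} (u v : Vec A n) → suc (lev _≟_ (toList u) (toList v)) ≤ 1 → u ≡ v
  suc-lev≤1⇒≡ u v (s≤s h) = trans (sym (cast-is-id refl u)) (toList-injective refl u v (lev≤0⇒≡ _ _ h))

  -- On strings of equal length, an insertion must be paid for by a deletion, so
  -- edit distance at most 1 only leaves room for a single substitution.
  lev≤1⇒agree-off : ∀ {n} (u v : Vec A n) → lev _≟_ (toList u) (toList v) ≤ 1 →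
                    ∀ {i j} → i ≢ j → lookup u i ≢ lookup v i → lookup u j ≡ lookup v j
  lev≤1⇒agree-off (x ∷ u) (y ∷ v) h {i} {j} i≢j uᵢ≢vᵢ with ⊓₃-≤⇒⊎ _ _ _ h
  ... | inj₁ (s≤s h′)        = ⊥-elim (toList≢∷toList u v y (lev≤0⇒≡ _ _ h′))
  ... | inj₂ (inj₁ (s≤s h′)) = ⊥-elim (toList≢∷toList v u x (sym (lev≤0⇒≡ _ _ h′)))
  ... | inj₂ (inj₂ h′) with x ≟ y | i | j
  ...   | yes x≡y | zero   | _      = ⊥-elim (uᵢ≢vᵢ x≡y)
  ...   | yes x≡y | suc _  | zero   = x≡y
  ...   | yes _   | suc _  | suc _  = lev≤1⇒agree-off u v h′ (λ i≡j → i≢j (cong suc i≡j)) uᵢ≢vᵢ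
  ...   | no _    | zero   | zero   = ⊥-elim (i≢j refl)
  ...   | no _    | suc i′ | _      = ⊥-elim (uᵢ≢vᵢ (cong (λ w → lookup w i′) (suc-lev≤1⇒≡ u v h′)))
  ...   | no _    | zero   | suc j′ = cong (λ w → lookup w j′) (suc-lev≤1⇒≡ u v h′)

other : ∀ {q} → Fin (suc (suc q)) → Fin (suc (suc q))
other zero    = suc zero
other (suc _) = zero

other-≢ : ∀ {q} (c : Fin (suc (suc q))) → other c ≢ c
other-≢ zero    ()
other-≢ (suc _) ()

module _ {q n : ℕ} (s : Str (suc (suc q)) n) where

  neighbour : Fin n → Str (suc (suc q)) n
  neighbour i = s [ i ]≔ other (lookup s i)

  edit-neighbour≤1 : ∀ i → edit s (neighbour i) ≤ 1
  edit-neighbour≤1 i = lev-[]≔≤1 Fin._≟_ s i (other (lookup s i))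

  edit-neighbours≥2 : ∀ {i j} → i ≢ j → edit (neighbour i) (neighbour j) ≥ 2
  edit-neighbours≥2 {i} {j} i≢j = ≰⇒> λ close →
    other-≢ (lookup s j) (sym (begin
      lookup s j               ≡⟨ lookup∘update′ (λ j≡i → i≢j (sym j≡i)) s _ ⟨
      lookup (neighbour i) j   ≡⟨ lev≤1⇒agree-off Fin._≟_ (neighbour i) (neighbour j) close i≢j differ-at-i ⟩
      lookup (neighbour j) j   ≡⟨ lookup∘update j s _ ⟩
      other (lookup s j)       ∎))
    where
    open ≡-Reasoning
    differ-at-i : lookup (neighbour i) i ≢ lookup (neighbour j) i
    differ-at-i eq = other-≢ (lookup s i)
      (trans (sym (lookup∘update i s _)) (trans eq (lookup∘update′ i≢j s _)))

sensitive⇒atLeast-length : ∀ {b} {q n} {B : Set b} (f : Bucketing (suc (suc q)) n B) →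
                           Sensitive 1 2 f → (s : Str (suc (suc q)) n) → AtLeast n (f s)
sensitive⇒atLeast-length {n = n} {B} f (near , far) s = bucket , bucket-injective , λ i → proj₁ (proj₂ (shared i))
  where
  shared : ∀ i → Σ B (λ x → f s x × f (neighbour s i) x)
  shared i = near s (neighbour s i) (edit-neighbour≤1 s i)

  bucket : Fin n → B
  bucket i = proj₁ (shared i)

  bucket-injective : ∀ {i j} → bucket i ≡ bucket j → i ≡ j
  bucket-injective {i} {j} bᵢ≡bⱼ = decidable-stable (i Fin.≟ j) λ i≢j →
    far (neighbour s i) (neighbour s j) (edit-neighbours≥2 s i≢j) (bucket j)
      (subst (f (neighbour s i)) bᵢ≡bⱼ (proj₂ (proj₂ (shared i))) , proj₂ (proj₂ (shared j)))

lemma2 : ∀ {b : Level} (q n : ℕ) → q ≥ 2 → n ≥ 1 → (B : Set b) (f : Bucketing q n B) →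
         Sensitive 1 2 f → (s : Str q n) → AtLeast n (f s)
lemma2 (suc (suc _)) _ _ _ _ = sensitive⇒atLeast-length
lemma2 (suc zero)    _ (s≤s ()) _
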